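{- Let $G=(A\cup B,E)$ be an instance of the strongly stable matching problem and let $M$ be a strongly stable matching of $G$. Then $[M]=\bigvee C(U(M))$.
   Context: An instance of the strongly stable matching problem is a finite bipartite graph $G=(A\cup B,E)$ (vertices of $A$ are "men", of $B$ "women") in which every vertex $v$ has a preference list: its neighbours are partitioned into disjoint ties (possibly singletons) which are linearly ordered. For neighbours $x,y$ of $v$ write $x\succ_v y$ if $x$ lies in a strictly earlier tie than $y$, $x=_v y$ if in the same tie, $x\succeq_v y$ if either. A matching is a set of pairwise vertex-disjoint edges; $M(v)$ is the partner of $v$. An edge $e\in E\setminus M$ blocks $M$ if its endpoints can be labelled $x,y$ with ($x$ unmatched or $y\succ_x M(x)$) and ($y$ unmatched or $x\succeq_y M(y)$); $M$ is strongly stable if no edge blocks it. All strongly stable matchings match the same vertices. For strongly stable $M,N$: $M\succeq N$ ($M$ dominates $N$) if $M(m)\succeq_m N(m)$ for every matched man $m$; $M\sim N$ if $M(m)=_m N(m)$ for every matched man $m$; $[M]$ is the $\sim$-class of $M$, and $[M]\succeq[N]$ iff $M\succeq N$. The operation $M\vee N$ is the matching containing, for each matched man $m$, the edge $(m,N(m))$ if $M(m)\succ_m N(m)$ and $(m,M(m))$ otherwise; it is strongly stable, and $[M]\vee[N]:=[M\vee N]$ is well defined. For a nonempty finite set $S$ of classes, $\bigvee S$ is the iterated $\vee$ of its elements. For an edge $(a,b)$ ($a\in A$) contained in some strongly stable matching, let $N$ be a strongly stable matching containing $(a,b)$ that dominates every strongly stable matching containing $(a,b)$ (such $N$ exists);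 define $M(a,b):=[N]$. A class is irreducible if it equals $M(a,b)$ for some such edge; $I(\mathcal{M}_G)$ is the set of irreducible classes. For a strongly stable matching $M$, $U(M)=\{M(a,b):(a,b)\in M\}$, and $C(U(M))$ is the set of all irreducible classes that dominate some element of $U(M)$. -}

module Defs where

open import Data.Nat using (ℕ; _≤_; _<_; _<ᵇ_)
open import Data.Fin using (Fin)
open import Data.Bool using (Bool; true; false; if_then_else_)
open import Data.Maybe using (Maybe; just; nothing)
open import Data.Product using (Σ; ∃; _×_; _,_)
open import Data.Sum using (_⊎_)
open import Data.List using (List; []; _∷_; foldl)
open import Data.List.Relation.Unary.All using (All)
open import Data.List.Relation.Unary.Any using (Any)
open import Data.List.Relation.Unary.AllPairs using (AllPairs)
open import Relation.Binary.PropositionalEquality using (_≡_)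
open import Relation.Nullary using (¬_)

-- An instance: men = Fin m, women = Fin n.
-- Preference lists with ties are encoded by ranks: for a neighbour x of v,
-- rank v x is the index of the tie containing x (smaller = better).
-- Ranks of non-neighbours are irrelevant.
record Instance (m n : ℕ) : Set where
  field
    E     : Fin m → Fin n → Bool
    rankA : Fin m → Fin n → ℕ
    rankB : Fin n → Fin m → ℕ

-- A matching is represented by the partner function of the men.
Matching : ℕ → ℕ → Set
Matching m n = Fin m → Maybe (Fin n)

module _ {m n : ℕ} (G : Instance m n) where
  open Instance G

  IsMatching : Matching m n → Set
  IsMatching M =
    (∀ a b → M a ≡ just b → E a b ≡ true) ×
    (∀ a a' b → M a ≡ just b → M a' ≡ just b → a ≡ a')

  WUnmatched : Matching m n → Fin n → Set
  WUnmatched M b = ∀ a → ¬ (M a ≡ just b)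

  ManStrict : Matching m n → Fin m → Fin n → Set
  ManStrict M a b = (M a ≡ nothing) ⊎ (∃ λ b' → M a ≡ just b' × rankA a b < rankA a b')

  ManWeak : Matching m n → Fin m → Fin n → Set
  ManWeak M a b = (M a ≡ nothing) ⊎ (∃ λ b' → M a ≡ just b' × rankA a b ≤ rankA a b')

  WomanStrict : Matching m n → Fin m → Fin n → Set
  WomanStrict M a b = WUnmatched M b ⊎ (∃ λ a' → M a' ≡ just b × rankB b a < rankB b a')

  WomanWeak : Matching m n → Fin m → Fin n → Set
  WomanWeak M a b = WUnmatched M b ⊎ (∃ λ a' → M a' ≡ just b × rankB b a ≤ rankB b a')

  Blocks : Matching m n → Fin m → Fin n → Set
  Blocks M a b =
    E a b ≡ true × ¬ (M a ≡ just b) ×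
    ((ManStrict M a b × WomanWeak M a b) ⊎ (WomanStrict M a b × ManWeak M a b))

  StronglyStable : Matching m n → Set
  StronglyStable M = IsMatching M × (∀ a b → ¬ Blocks M a b)

  _⪰_ : Matching m n → Matching m n → Set
  M ⪰ N = ∀ a b c → M a ≡ just b → N a ≡ just c → rankA a b ≤ rankA a c

  _∼_ : Matching m n → Matching m n → Set
  M ∼ N = ∀ a b c → M a ≡ just b → N a ≡ just c → rankA a b ≡ rankA a c

  _∨_ : Matching m n → Matching m n → Matching m n
  (M ∨ N) a with M a | N a
  ... | just b | just c = if rankA a b <ᵇ rankA a c then just c else just b
  ... | Mb     | _      = Mb

  ⋁ : Matching m n → List (Matching m n) → Matching m n
  ⋁ X Xs = foldl _∨_ X Xs

  -- N is a strongly stable matching containing (a,b) dominating every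
  -- strongly stable matching containing (a,b); its class is M(a,b).
  IsTop : Fin m → Fin n → Matching m n → Set
  IsTop a b N = StronglyStable N × N a ≡ just b ×
    (∀ N' → StronglyStable N' → N' a ≡ just b → N ⪰ N')

  InClassM : Fin m → Fin n → Matching m n → Set
  InClassM a b X = ∃ λ N → IsTop a b N × X ∼ N

  Irreducible : Matching m n → Set
  Irreducible X = ∃ λ a → ∃ λ b → InClassM a b X

  -- [X] dominates some element of U(M) = { M(a,b) : (a,b) ∈ M }
  DominatesSomeU : Matching m n → Matching m n → Set
  DominatesSomeU M X = ∃ λ a → ∃ λ b → M a ≡ just b × ∃ λ N → IsTop a b N × X ⪰ N

  InC : Matching m n → Matching m n → Set
  InC M X = StronglyStable X × Irreducible X × DominatesSomeU M X

  -- The list Xs lists representatives of the classes in C(U(M)),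
  -- each class exactly once.
  RepresentsC : Matching m n → List (Matching m n) → Set
  RepresentsC M Xs =
    All (InC M) Xs ×
    (∀ Y → InC M Y → Any (λ X → Y ∼ X) Xs) ×
    AllPairs (λ X Y → ¬ (X ∼ Y)) Xs

module Submission where

-- Fix a man a with M a ≡ just b and ⋁ X Xs a ≡ just c, where X ∷ Xs lists the
-- classes of C(U(M)).  We prove rankA a b ≡ rankA a c by two inequalities.
--  * Every class in C(U(M)) dominates some top matching M(a',b') with (a',b') ∈ M,
--    which dominates M; the join gives a the worst listed partner, so c ⪰ₐ b.
--  * The top matching N of (a,b) itself lies in C(U(M)), so a listed Y ∼ N gives
--    a a partner of b's rank, which is at least as good as c: b ⪰ₐ c.
-- The second step needs top matchings to exist.  The meet P ∧ Q of two strongly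
-- stable matchings (each man takes the better partner) is strongly stable, and
-- meeting with a matching that beats the current one lowers the total rank; so a top
-- matching exists under ¬¬, enough since the goal is a decidable equation.  Stability
-- of the meet and the rural hospitals theorem both rest on one finiteness principle:
-- an alternating path between two matchings cannot go on forever.

open import Defs
open import Data.Nat using (ℕ; zero; suc; _≤_; _<_; _<ᵇ_; _+_; z≤n; s≤s; _≤?_; _≟_)
open import Data.Nat.Properties
open import Data.Nat.Induction using (<-wellFounded)
open import Data.Fin using (Fin; zero; suc; toℕ) renaming (_≟_ to _≟ᶠ_)
open import Data.Fin.Properties using (any?; pigeonhole)
open import Data.Bool using (true; false; if_then_else_)
open import Data.Maybe using (Maybe; just; nothing)
open import Data.Maybe.Properties using (just-injective) renaming (≡-dec to ≡-decᵐ)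
open import Data.Product using (Σ; ∃; _×_; _,_; proj₁; proj₂)
open import Data.Sum using (_⊎_; inj₁; inj₂; [_,_])
open import Data.Empty using (⊥; ⊥-elim)
open import Data.List using (List; []; _∷_)
open import Data.List.Relation.Unary.All as All using (All; []; _∷_)
open import Effect.Monad using (RawMonad)
open import Induction.WellFounded using (Acc; acc)
open import Level using (0ℓ)
open import Relation.Binary.PropositionalEquality using (_≡_; refl; sym; trans; cong; subst; subst₂)
open import Relation.Nullary using (¬_; Dec; yes; no)
open import Relation.Nullary.Reflects using (ofʸ; ofⁿ)
open import Relation.Nullary.Decidable using (decidable-stable; ¬¬-excluded-middle)
open import Relation.Nullary.Negation using (¬¬-Monad; ¬¬-map)

open RawMonad (¬¬-Monad {a = 0ℓ}) using (pure; _>>=_)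

partner-cases : ∀ {A : Set} (v : Maybe A) → v ≡ nothing ⊎ ∃ λ x → v ≡ just x
partner-cases nothing  = inj₁ refl
partner-cases (just x) = inj₂ (x , refl)

same-partner : ∀ {A : Set} {v : Maybe A} {x y : A} → v ≡ just x → v ≡ just y → x ≡ y
same-partner v≡x v≡y = just-injective (trans (sym v≡x) v≡y)

just≢nothing : ∀ {A : Set} {x : A} → ¬ (just x ≡ nothing)
just≢nothing ()

sumFin : ∀ k → (Fin k → ℕ) → ℕ
sumFin zero    f = 0
sumFin (suc k) f = f zero + sumFin k (λ i → f (suc i))

sumFin-mono : ∀ k (f g : Fin k → ℕ) → (∀ i → f i ≤ g i) → sumFin k f ≤ sumFin k g
sumFin-mono zero    f g f≤g = z≤n
sumFin-mono (suc k) f g f≤g = +-mono-≤ (f≤g zero) (sumFin-mono k _ _ (λ i → f≤g (suc i)))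

sumFin-strict : ∀ k (f g : Fin k → ℕ) → (∀ i → f i ≤ g i) → ∀ j → f j < g j →
  sumFin k f < sumFin k g
sumFin-strict (suc k) f g f≤g zero    fj<gj =
  +-mono-<-≤ fj<gj (sumFin-mono k _ _ (λ i → f≤g (suc i)))
sumFin-strict (suc k) f g f≤g (suc j) fj<gj =
  +-mono-≤-< (f≤g zero) (sumFin-strict k _ _ (λ i → f≤g (suc i)) j fj<gj)

module _ {m n : ℕ} (G : Instance m n) where
  open Instance G

  private
    SS : Matching m n → Set
    SS = StronglyStable G

  RankAtMost : Fin m → ℕ → Matching m n → Set
  RankAtMost a B Z = ∀ e → Z a ≡ just e → rankA a e ≤ B

  ∨-source : ∀ P Q a c → (_∨_ G P Q) a ≡ just c → P a ≡ just c ⊎ Q a ≡ just c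
  ∨-source P Q a c eq with P a | Q a
  ∨-source P Q a c refl | just b | nothing = inj₁ refl
  ∨-source P Q a c eq   | just b | just d with rankA a b <ᵇ rankA a d
  ∨-source P Q a c refl | just b | just d | true  = inj₂ refl
  ∨-source P Q a c refl | just b | just d | false = inj₁ refl

  ∨-worst : ∀ P Q a d → P a ≡ just d →
    ∃ λ c → (_∨_ G P Q) a ≡ just c × rankA a d ≤ rankA a c ×
            (∀ e → Q a ≡ just e → rankA a e ≤ rankA a c)
  ∨-worst P Q a d eq with P a | Q a
  ∨-worst P Q a d refl | just .d | nothing = d , refl , ≤-refl , λ e ()
  ∨-worst P Q a d refl | just .d | just e
    with rankA a d <ᵇ rankA a e | <ᵇ-reflects-< (rankA a d) (rankA a e)
  ... | true  | ofʸ d<e = e , refl , <⇒≤ d<e , λ { e' refl → ≤-refl }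
  ... | false | ofⁿ d≮e = d , refl , ≤-refl , λ { e' refl → ≮⇒≥ d≮e }

  ∨-bounded : ∀ P Q a B → RankAtMost a B P → RankAtMost a B Q → RankAtMost a B (_∨_ G P Q)
  ∨-bounded P Q a B P≤B Q≤B e eq = [ P≤B e , Q≤B e ] (∨-source P Q a e eq)

  ∨-bounded⁻¹ : ∀ P Q a B d → P a ≡ just d → RankAtMost a B (_∨_ G P Q) →
    RankAtMost a B P × RankAtMost a B Q
  ∨-bounded⁻¹ P Q a B d Pa≡d P∨Q≤B with ∨-worst P Q a d Pa≡d
  ... | c , join≡c , d≤c , Q≤c =
    (λ e Pa≡e → ≤-trans (subst (λ x → rankA a x ≤ rankA a c) (same-partner Pa≡d Pa≡e) d≤c)
                        c≤B) ,
    (λ e Qa≡e → ≤-trans (Q≤c e Qa≡e) c≤B)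
    where
    c≤B : rankA a c ≤ B
    c≤B = P∨Q≤B c join≡c

  ⋁-bounded : ∀ a B Y Xs → RankAtMost a B Y → All (RankAtMost a B) Xs →
    RankAtMost a B (⋁ G Y Xs)
  ⋁-bounded a B Y []       Y≤B []          = Y≤B
  ⋁-bounded a B Y (Z ∷ Zs) Y≤B (Z≤B ∷ Zs≤B) =
    ⋁-bounded a B (_∨_ G Y Z) Zs (∨-bounded Y Z a B Y≤B Z≤B) Zs≤B

  ⋁-bounded⁻¹ : ∀ a B Y Xs d → Y a ≡ just d → RankAtMost a B (⋁ G Y Xs) →
    All (RankAtMost a B) (Y ∷ Xs)
  ⋁-bounded⁻¹ a B Y []       d Ya≡d ⋁≤B = ⋁≤B ∷ []
  ⋁-bounded⁻¹ a B Y (Z ∷ Zs) d Ya≡d ⋁≤B with ∨-worst Y Z a d Ya≡d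
  ... | c , join≡c , _ with ⋁-bounded⁻¹ a B (_∨_ G Y Z) Zs c join≡c ⋁≤B
  ... | join≤B ∷ Zs≤B with ∨-bounded⁻¹ Y Z a B d Ya≡d join≤B
  ... | Y≤B , Z≤B = Y≤B ∷ Z≤B ∷ Zs≤B

  matching-edge : ∀ Y → SS Y → ∀ a b → Y a ≡ just b → E a b ≡ true
  matching-edge Y ssY = proj₁ (proj₁ ssY)

  matching-inj : ∀ Y → SS Y → ∀ x x' w → Y x ≡ just w → Y x' ≡ just w → x ≡ x'
  matching-inj Y ssY = proj₂ (proj₁ ssY)

  strict-not-matched : ∀ Y x w → ManStrict G Y x w → ¬ (Y x ≡ just w)
  strict-not-matched Y x w (inj₁ Yx≡∅) Yx≡w = just≢nothing (trans (sym Yx≡w) Yx≡∅)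
  strict-not-matched Y x w (inj₂ (w' , Yx≡w' , w<w')) Yx≡w =
    <-irrefl (cong (rankA x) (same-partner Yx≡w Yx≡w')) w<w'

  private
    woman-decides : (Y : Matching m n) (w : Fin n) → Dec (∃ λ y → Y y ≡ just w)
    woman-decides Y w = any? (λ y → ≡-decᵐ _≟ᶠ_ (Y y) (just w))

  woman-has-better-partner : ∀ Y x w → SS Y → E x w ≡ true → ManStrict G Y x w →
    ∃ λ y → Y y ≡ just w × rankB w y < rankB w x
  woman-has-better-partner Y x w ssY e x≻ with woman-decides Y w
  ... | yes (y , Yy≡w) = y , Yy≡w , ≰⇒> λ x⪰y →
    proj₂ ssY x w (e , strict-not-matched Y x w x≻ , inj₁ (x≻ , inj₂ (y , Yy≡w , x⪰y)))
  ... | no w-single = ⊥-elim (proj₂ ssY x w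
    (e , strict-not-matched Y x w x≻ , inj₁ (x≻ , inj₁ λ y Yy≡w → w-single (y , Yy≡w))))

  woman-has-weakly-better-partner : ∀ Y x w → SS Y → E x w ≡ true → ¬ (Y x ≡ just w) →
    ManWeak G Y x w → ∃ λ y → Y y ≡ just w × rankB w y ≤ rankB w x
  woman-has-weakly-better-partner Y x w ssY e x∉Y x⪰ with woman-decides Y w
  ... | yes (y , Yy≡w) = y , Yy≡w , ≮⇒≥ λ x≻y →
    proj₂ ssY x w (e , x∉Y , inj₂ (inj₂ (y , Yy≡w , x≻y) , x⪰))
  ... | no w-single = ⊥-elim
    (proj₂ ssY x w (e , x∉Y , inj₂ (inj₁ (λ y Yy≡w → w-single (y , Yy≡w)) , x⪰)))

  man-has-better-partner : ∀ Y x w → SS Y → E x w ≡ true → ¬ (Y x ≡ just w) →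
    WomanStrict G Y x w → ∃ λ w' → Y x ≡ just w' × rankA x w' < rankA x w
  man-has-better-partner Y x w ssY e x∉Y w≻ with partner-cases (Y x)
  ... | inj₁ Yx≡∅ = ⊥-elim (proj₂ ssY x w (e , x∉Y , inj₂ (w≻ , inj₁ Yx≡∅)))
  ... | inj₂ (w' , Yx≡w') with rankA x w ≤? rankA x w'
  ...   | yes w⪰w' =
    ⊥-elim (proj₂ ssY x w (e , x∉Y , inj₂ (w≻ , inj₂ (w' , Yx≡w' , w⪰w'))))
  ...   | no  w≺w' = w' , Yx≡w' , ≰⇒> w≺w'

  -- Let H be injective, and suppose every man x in a set I is H-matched and has a
  -- successor y ∈ I whose F-partner is x's H-partner.  Then no x₀ ∈ I can start a
  -- path, i.e. have an F-partner that is no I-man's H-partner: iterating the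
  -- successor map would give infinitely many distinct men (pigeonhole).
  no-infinite-path : (F H : Matching m n) (I : Fin m → Set) →
    (∀ x x' w → H x ≡ just w → H x' ≡ just w → x ≡ x') →
    (∀ x → I x → ∃ λ w → H x ≡ just w) →
    (∀ x → I x → ∃ λ y → F y ≡ H x × I y) →
    ∀ x₀ → I x₀ → (∀ x → I x → ¬ (H x ≡ F x₀)) → ⊥
  no-infinite-path F H I H-inj H-matched next x₀ I-x₀ start =
    repeats (pigeonhole (n<1+n m) (λ k → man (toℕ k)))
    where
    walk : ℕ → Σ (Fin m) I
    walk zero    = x₀ , I-x₀
    walk (suc k) = proj₁ (next _ (proj₂ (walk k))) , proj₂ (proj₂ (next _ (proj₂ (walk k))))

    man : ℕ → Fin m
    man k = proj₁ (walk k)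

    link : ∀ k → F (man (suc k)) ≡ H (man k)
    link k = proj₁ (proj₂ (next _ (proj₂ (walk k))))

    distinct : ∀ i j → i < j → ¬ (man i ≡ man j)
    distinct zero    (suc j) _         same =
      start _ (proj₂ (walk j)) (trans (sym (link j)) (cong F (sym same)))
    distinct (suc i) (suc j) (s≤s i<j) same = distinct i j i<j
      (H-inj _ _ _ Hi≡w (trans (sym Hi≡Hj) Hi≡w))
      where
      Hi≡w : H (man i) ≡ just (proj₁ (H-matched _ (proj₂ (walk i))))
      Hi≡w = proj₂ (H-matched _ (proj₂ (walk i)))

      Hi≡Hj : H (man i) ≡ H (man j)
      Hi≡Hj = trans (sym (link i)) (trans (cong F same) (link j))

    repeats : (∃ λ i → ∃ λ j → toℕ i < toℕ j × man (toℕ i) ≡ man (toℕ j)) → ⊥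
    repeats (i , j , i<j , same) = distinct _ _ i<j same

  ImprovedIn : Matching m n → Matching m n → Fin m → Set
  ImprovedIn M N x = ∃ λ w → N x ≡ just w × ManStrict G M x w

  -- The M-partner y of such a woman w is again improved in N: w prefers y to x,
  -- so stability of N forces y to do strictly better than w.
  improved-step : ∀ M N → SS M → SS N → ∀ x → ImprovedIn M N x →
    ∃ λ y → M y ≡ N x × ImprovedIn M N y
  improved-step M N ssM ssN x (w , Nx≡w , x≻)
    with woman-has-better-partner M x w ssM (matching-edge N ssN x w Nx≡w) x≻
  ... | y , My≡w , y≻x
    with man-has-better-partner N y w ssN (matching-edge M ssM y w My≡w) y∉N
           (inj₂ (x , Nx≡w , y≻x))
    where
    y∉N : ¬ (N y ≡ just w)
    y∉N Ny≡w = <-irrefl (cong (rankB w) (matching-inj N ssN y x w Ny≡w Nx≡w)) y≻x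
  ... | w' , Ny≡w' , w'≻w =
    y , trans My≡w (sym Nx≡w) , w' , Ny≡w' , inj₂ (w , My≡w , w'≻w)

  -- Rural hospitals (men's side): a man single in M is single in every strongly stable
  -- N, since a man matched in N only would start an infinite path of improved men.
  rural-hospitals : ∀ M N → SS M → SS N → ∀ a → M a ≡ nothing → N a ≡ nothing
  rural-hospitals M N ssM ssN a Ma≡∅ with partner-cases (N a)
  ... | inj₁ Na≡∅ = Na≡∅
  ... | inj₂ (w , Na≡w) = ⊥-elim (no-infinite-path M N (ImprovedIn M N) (matching-inj N ssN)
        (λ x (w , Nx≡w , _) → w , Nx≡w) (improved-step M N ssM ssN)
        a (w , Na≡w , inj₁ Ma≡∅)
        λ x (_ , Nx≡w' , _) Nx≡Ma → just≢nothing (trans (sym Nx≡w') (trans Nx≡Ma Ma≡∅)))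

  stays-matched : ∀ M N → SS M → SS N → ∀ {a b} → M a ≡ just b → ∃ λ c → N a ≡ just c
  stays-matched M N ssM ssN {a} Ma≡b with partner-cases (N a)
  ... | inj₁ Na≡∅ =
    ⊥-elim (just≢nothing (trans (sym Ma≡b) (rural-hospitals N M ssN ssM a Na≡∅)))
  ... | inj₂ matched = matched

  ⪰-trans : ∀ P Q R → SS Q → SS R → _⪰_ G P Q → _⪰_ G Q R → _⪰_ G P R
  ⪰-trans P Q R ssQ ssR P⪰Q Q⪰R a b c Pa≡b Ra≡c with stays-matched R Q ssR ssQ Ra≡c
  ... | d , Qa≡d = ≤-trans (P⪰Q a b d Pa≡b Qa≡d) (Q⪰R a d c Qa≡d Ra≡c)

  _∧_ : Matching m n → Matching m n → Matching m n
  (P ∧ Q) x with P x | Q x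
  ... | just b | just c = if rankA x c <ᵇ rankA x b then just c else just b
  ... | Pb     | _      = Pb

  Keeps : Matching m n → Matching m n → Fin m → Fin n → Set
  Keeps P Q x w = P x ≡ just w × (∀ c → Q x ≡ just c → rankA x w ≤ rankA x c)

  Switches : Matching m n → Matching m n → Fin m → Fin n → Set
  Switches P Q x w = Q x ≡ just w × ∃ λ b → P x ≡ just b × rankA x w < rankA x b

  ∧-cases : ∀ P Q x w → (P ∧ Q) x ≡ just w → Keeps P Q x w ⊎ Switches P Q x w
  ∧-cases P Q x w eq with P x | Q x
  ∧-cases P Q x w refl | just .w | nothing = inj₁ (refl , λ c ())
  ∧-cases P Q x w eq   | just b  | just c
    with rankA x c <ᵇ rankA x b | <ᵇ-reflects-< (rankA x c) (rankA x b)
  ∧-cases P Q x w refl | just b  | just .w | true  | ofʸ w<b = inj₂ (refl , b , refl , w<b)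
  ∧-cases P Q x w refl | just .w | just c  | false | ofⁿ c≮w =
    inj₁ (refl , λ { c' refl → ≮⇒≥ c≮w })

  ∧-nothing : ∀ P Q x → P x ≡ nothing → (P ∧ Q) x ≡ nothing
  ∧-nothing P Q x eq with P x | Q x
  ∧-nothing P Q x refl | nothing | _ = refl

  ∧-just : ∀ P Q x b → P x ≡ just b → ∃ λ w → (P ∧ Q) x ≡ just w
  ∧-just P Q x b eq with P x | Q x
  ∧-just P Q x b refl | just .b | nothing = b , refl
  ∧-just P Q x b refl | just .b | just c with rankA x c <ᵇ rankA x b
  ... | true  = c , refl
  ... | false = b , refl

  SameMen : Matching m n → Matching m n → Fin m → Set
  SameMen Y Z x =
    (Y x ≡ nothing → Z x ≡ nothing) × (∀ u → Y x ≡ just u → ∃ λ c → Z x ≡ just c)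

  man-strict-transfer : ∀ Y Z x w → _⪰_ G Y Z → SameMen Y Z x →
    ManStrict G Y x w → ManStrict G Z x w
  man-strict-transfer Y Z x w Y⪰Z (single , _) (inj₁ Yx≡∅) = inj₁ (single Yx≡∅)
  man-strict-transfer Y Z x w Y⪰Z (_ , matched) (inj₂ (u , Yx≡u , w≻u)) with matched u Yx≡u
  ... | c , Zx≡c = inj₂ (c , Zx≡c , <-≤-trans w≻u (Y⪰Z x u c Yx≡u Zx≡c))

  man-weak-transfer : ∀ Y Z x w → _⪰_ G Y Z → SameMen Y Z x →
    ManWeak G Y x w → ManWeak G Z x w
  man-weak-transfer Y Z x w Y⪰Z (single , _) (inj₁ Yx≡∅) = inj₁ (single Yx≡∅)
  man-weak-transfer Y Z x w Y⪰Z (_ , matched) (inj₂ (u , Yx≡u , w⪰u)) with matched u Yx≡u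
  ... | c , Zx≡c = inj₂ (c , Zx≡c , ≤-trans w⪰u (Y⪰Z x u c Yx≡u Zx≡c))

  -- The woman-side blocking conditions: R is _≤_ for WomanWeak and _<_ for WomanStrict.
  WomanSide : (ℕ → ℕ → Set) → Matching m n → Fin m → Fin n → Set
  WomanSide R Y x w = WUnmatched G Y w ⊎ ∃ λ a' → Y a' ≡ just w × R (rankB w x) (rankB w a')

  module MeetOfStable (P Q : Matching m n) (ssP : SS P) (ssQ : SS Q) where

    L : Matching m n
    L = P ∧ Q

    L-single : ∀ x → L x ≡ nothing → P x ≡ nothing
    L-single x Lx≡∅ with partner-cases (P x)
    ... | inj₁ Px≡∅ = Px≡∅
    ... | inj₂ (b , Px≡b) with ∧-just P Q x b Px≡b
    ...   | u , Lx≡u = ⊥-elim (just≢nothing (trans (sym Lx≡u) Lx≡∅))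

    L-matched : ∀ x u → L x ≡ just u → ∃ λ b → P x ≡ just b
    L-matched x u Lx≡u with ∧-cases P Q x u Lx≡u
    ... | inj₁ (Px≡u , _)         = u , Px≡u
    ... | inj₂ (_ , b , Px≡b , _) = b , Px≡b

    L-edge : ∀ x u → L x ≡ just u → E x u ≡ true
    L-edge x u Lx≡u with ∧-cases P Q x u Lx≡u
    ... | inj₁ (Px≡u , _) = matching-edge P ssP x u Px≡u
    ... | inj₂ (Qx≡u , _) = matching-edge Q ssQ x u Qx≡u

    L⪰P : _⪰_ G L P
    L⪰P x u b Lx≡u Px≡b with ∧-cases P Q x u Lx≡u
    ... | inj₁ (Px≡u , _)           = ≤-reflexive (cong (rankA x) (same-partner Px≡u Px≡b))
    ... | inj₂ (_ , b' , Px≡b' , u≻b') =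
      <⇒≤ (subst (λ z → rankA x u < rankA x z) (same-partner Px≡b' Px≡b) u≻b')

    L⪰Q : _⪰_ G L Q
    L⪰Q x u c Lx≡u Qx≡c with ∧-cases P Q x u Lx≡u
    ... | inj₁ (_ , u⪰Q) = u⪰Q c Qx≡c
    ... | inj₂ (Qx≡u , _) = ≤-reflexive (cong (rankA x) (same-partner Qx≡u Qx≡c))

    same-men-P : ∀ x → SameMen L P x
    same-men-P x = L-single x , L-matched x

    same-men-Q : ∀ x → SameMen L Q x
    same-men-Q x = (λ Lx≡∅ → rural-hospitals P Q ssP ssQ x (L-single x Lx≡∅)) ,
                   (λ u Lx≡u → stays-matched P Q ssP ssQ (proj₂ (L-matched x u Lx≡u)))

    -- If x₁ keeps his P-partner w and x₂ switches to w, then x₁ = x₂: otherwise w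
    -- would prefer x₁ to x₂ by stability of P, and x₂ to x₁ (weakly) by that of Q.
    keeper-is-switcher : ∀ x₁ x₂ w → Keeps P Q x₁ w → Switches P Q x₂ w → x₁ ≡ x₂
    keeper-is-switcher x₁ x₂ w (Px₁≡w , w⪰Q) x₂-switches@(Qx₂≡w , _)
      with ≡-decᵐ _≟ᶠ_ (Q x₁) (just w)
    ... | yes Qx₁≡w = matching-inj Q ssQ x₁ x₂ w Qx₁≡w Qx₂≡w
    ... | no  x₁∉Q  = ⊥-elim (<⇒≱ x₁≻x₂ x₂⪰x₁)
      where
      x₁≻x₂ : rankB w x₁ < rankB w x₂
      x₁≻x₂ with woman-has-better-partner P x₂ w ssP (matching-edge Q ssQ x₂ w Qx₂≡w)
                   (inj₂ (proj₂ x₂-switches))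
      ... | y , Py≡w , y≻x₂ =
        subst (λ z → rankB w z < rankB w x₂) (matching-inj P ssP y x₁ w Py≡w Px₁≡w) y≻x₂

      x₂⪰x₁ : rankB w x₂ ≤ rankB w x₁
      x₂⪰x₁ with stays-matched P Q ssP ssQ Px₁≡w
      ... | c , Qx₁≡c with woman-has-weakly-better-partner Q x₁ w ssQ
                             (matching-edge P ssP x₁ w Px₁≡w) x₁∉Q
                             (inj₂ (c , Qx₁≡c , w⪰Q c Qx₁≡c))
      ... | y , Qy≡w , y⪰x₁ =
        subst (λ z → rankB w z ≤ rankB w x₁) (matching-inj Q ssQ y x₂ w Qy≡w Qx₂≡w) y⪰x₁

    L-inj : ∀ x x' w → L x ≡ just w → L x' ≡ just w → x ≡ x'
    L-inj x x' w Lx≡w Lx'≡w with ∧-cases P Q x w Lx≡w | ∧-cases P Q x' w Lx'≡w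
    ... | inj₁ (Px≡w , _) | inj₁ (Px'≡w , _) = matching-inj P ssP x x' w Px≡w Px'≡w
    ... | inj₂ (Qx≡w , _) | inj₂ (Qx'≡w , _) = matching-inj Q ssQ x x' w Qx≡w Qx'≡w
    ... | inj₁ keeps      | inj₂ switches    = keeper-is-switcher x x' w keeps switches
    ... | inj₂ switches   | inj₁ keeps       = sym (keeper-is-switcher x' x w keeps switches)

    Switched : Fin m → Set
    Switched y = ∃ λ t → L y ≡ just t × Switches P Q y t

    -- The P-partner y' of that woman t prefers y to her, so y' also switched in L.
    switched-step : ∀ y → Switched y → ∃ λ y' → P y' ≡ Q y × Switched y'
    switched-step y (t , Ly≡t , Qy≡t , y-switches)
      with woman-has-better-partner P y t ssP (matching-edge Q ssQ y t Qy≡t) (inj₂ y-switches)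
    ... | y' , Py'≡t , y'≻y with ∧-just P Q y' t Py'≡t
    ... | t' , Ly'≡t' with ∧-cases P Q y' t' Ly'≡t'
    ... | inj₁ (Py'≡t' , _) = ⊥-elim (<-irrefl (cong (rankB t) (L-inj y' y t Ly'≡t Ly≡t)) y'≻y)
      where
      Ly'≡t : L y' ≡ just t
      Ly'≡t = trans Ly'≡t' (cong just (same-partner Py'≡t' Py'≡t))
    ... | inj₂ y'-switches = y' , trans Py'≡t (sym Qy≡t) , t' , Ly'≡t' , y'-switches

    -- A woman single in L is single in P: a P-partner would start an infinite
    -- path of switched men.
    L-single-woman : ∀ w → WUnmatched G L w → WUnmatched G P w
    L-single-woman w w∉L y₀ Py₀≡w with ∧-just P Q y₀ w Py₀≡w
    ... | u , Ly₀≡u with ∧-cases P Q y₀ u Ly₀≡u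
    ... | inj₁ (Py₀≡u , _) = w∉L y₀ (trans Ly₀≡u (cong just (same-partner Py₀≡u Py₀≡w)))
    ... | inj₂ y₀-switches =
      no-infinite-path P Q Switched (matching-inj Q ssQ) (λ x (t , _ , Qx≡t , _) → t , Qx≡t)
        switched-step y₀ (u , Ly₀≡u , y₀-switches)
        λ x (t , Lx≡t , Qx≡t , _) Qx≡Py₀ →
          w∉L x (trans Lx≡t (trans (sym Qx≡t) (trans Qx≡Py₀ Py₀≡w)))

    woman-side-transfer : ∀ R x w → ¬ (L x ≡ just w) → WomanSide R L x w →
      (WomanSide R P x w × ¬ (P x ≡ just w)) ⊎ (WomanSide R Q x w × ¬ (Q x ≡ just w))
    woman-side-transfer R x w x∉L (inj₁ w∉L) = inj₁ (inj₁ w∉P , w∉P x)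
      where
      w∉P : WUnmatched G P w
      w∉P = L-single-woman w w∉L
    woman-side-transfer R x w x∉L (inj₂ (y , Ly≡w , xRy)) with ∧-cases P Q y w Ly≡w
    ... | inj₁ (Py≡w , _) = inj₁ (inj₂ (y , Py≡w , xRy) ,
          λ Px≡w → x∉L (trans (cong L (matching-inj P ssP x y w Px≡w Py≡w)) Ly≡w))
    ... | inj₂ (Qy≡w , _) = inj₂ (inj₂ (y , Qy≡w , xRy) ,
          λ Qx≡w → x∉L (trans (cong L (matching-inj Q ssQ x y w Qx≡w Qy≡w)) Ly≡w))

    -- A blocking pair of L would block P or Q.
    L-stable : SS L
    L-stable = (L-edge , L-inj) , unblocked
      where
      unblocked : ∀ x w → ¬ Blocks G L x w
      unblocked x w (e , x∉L , inj₁ (x≻ , w⪰)) with woman-side-transfer _≤_ x w x∉L w⪰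
      ... | inj₁ (w⪰P , x∉P) =
        proj₂ ssP x w (e , x∉P , inj₁ (man-strict-transfer L P x w L⪰P (same-men-P x) x≻ , w⪰P))
      ... | inj₂ (w⪰Q , x∉Q) =
        proj₂ ssQ x w (e , x∉Q , inj₁ (man-strict-transfer L Q x w L⪰Q (same-men-Q x) x≻ , w⪰Q))
      unblocked x w (e , x∉L , inj₂ (w≻ , x⪰)) with woman-side-transfer _<_ x w x∉L w≻
      ... | inj₁ (w≻P , x∉P) =
        proj₂ ssP x w (e , x∉P , inj₂ (w≻P , man-weak-transfer L P x w L⪰P (same-men-P x) x⪰))
      ... | inj₂ (w≻Q , x∉Q) =
        proj₂ ssQ x w (e , x∉Q , inj₂ (w≻Q , man-weak-transfer L Q x w L⪰Q (same-men-Q x) x⪰))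

    L-keeps : ∀ a b → P a ≡ just b → Q a ≡ just b → L a ≡ just b
    L-keeps a b Pa≡b Qa≡b with ∧-just P Q a b Pa≡b
    ... | u , La≡u with ∧-cases P Q a u La≡u
    ... | inj₁ (Pa≡u , _) = trans La≡u (cong just (same-partner Pa≡u Pa≡b))
    ... | inj₂ (Qa≡u , _) = trans La≡u (cong just (same-partner Qa≡u Qa≡b))

  partnerRank : Fin m → Maybe (Fin n) → ℕ
  partnerRank x nothing  = 0
  partnerRank x (just u) = rankA x u

  totalRank : Matching m n → ℕ
  totalRank Y = sumFin m (λ x → partnerRank x (Y x))

  totalRank-strict : ∀ Y Z → _⪰_ G Y Z → (∀ x → Z x ≡ nothing → Y x ≡ nothing) →
    ∀ x u b → Y x ≡ just u → Z x ≡ just b → rankA x u < rankA x b → totalRank Y < totalRank Z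
  totalRank-strict Y Z Y⪰Z single x u b Yx≡u Zx≡b u≻b =
    sumFin-strict m _ _ pointwise x
      (subst₂ (λ s t → partnerRank x s < partnerRank x t) (sym Yx≡u) (sym Zx≡b) u≻b)
    where
    pointwise : ∀ y → partnerRank y (Y y) ≤ partnerRank y (Z y)
    pointwise y with Y y in Yy | Z y in Zy
    ... | nothing | _       = z≤n
    ... | just u' | just b' = Y⪰Z y u' b' Yy Zy
    ... | just u' | nothing = ⊥-elim (just≢nothing (trans (sym Yy) (single y Zy)))

  meet-decreases : ∀ P Q (ssP : SS P) (ssQ : SS Q) x b c → P x ≡ just b → Q x ≡ just c →
    rankA x c < rankA x b → totalRank (P ∧ Q) < totalRank P
  meet-decreases P Q ssP ssQ x b c Px≡b Qx≡c c≻b with ∧-just P Q x b Px≡b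
  ... | u , Lx≡u = totalRank-strict L P L⪰P (λ y → ∧-nothing P Q y) x u b Lx≡u Px≡b
                     (≤-<-trans (L⪰Q x u c Lx≡u Qx≡c) c≻b)
    where open MeetOfStable P Q ssP ssQ

  -- Dominance compares ranks pointwise, so it is a stable proposition ...
  ⪰-stable : ∀ N N' → ¬ ¬ (_⪰_ G N N') → _⪰_ G N N'
  ⪰-stable N N' ¬¬N⪰N' a b c Na≡b N'a≡c =
    decidable-stable (rankA a b ≤? rankA a c) λ b≺c → ¬¬N⪰N' λ N⪰N' → b≺c (N⪰N' a b c Na≡b N'a≡c)

  beaten-somewhere : ∀ N N' → ¬ (_⪰_ G N N') →
    ¬ ¬ (∃ λ x → ∃ λ u → ∃ λ v → N x ≡ just u × N' x ≡ just v × rankA x v < rankA x u)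
  beaten-somewhere N N' N⋡N' none = N⋡N' λ x u v Nx≡u N'x≡v →
    decidable-stable (rankA x u ≤? rankA x v) λ u≰v → none (x , u , v , Nx≡u , N'x≡v , ≰⇒> u≰v)

  rival : ∀ a b N → ¬ (∀ N' → SS N' → N' a ≡ just b → _⪰_ G N N') →
    ¬ ¬ (∃ λ N' → SS N' × N' a ≡ just b × ¬ (_⪰_ G N N'))
  rival a b N not-top none =
    not-top λ N' ssN' N'a≡b → ⪰-stable N N' λ N⋡N' → none (N' , ssN' , N'a≡b , N⋡N')

  -- Well-founded recursion on the total rank: either N is top, or meeting N with
  -- a rival gives a strongly stable matching containing (a,b) of smaller total rank.
  top-exists-from : ∀ a b N → Acc _<_ (totalRank N) → SS N → N a ≡ just b → ¬ ¬ ∃ (IsTop G a b)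
  top-exists-from a b N (acc smaller) ssN Na≡b = ¬¬-excluded-middle >>= decide
    where
    decide : Dec (∀ N' → SS N' → N' a ≡ just b → _⪰_ G N N') → ¬ ¬ ∃ (IsTop G a b)
    decide (yes N-top) = pure (N , ssN , Na≡b , N-top)
    decide (no not-top) = do
      (N' , ssN' , N'a≡b , N⋡N') ← rival a b N not-top
      (x , u , v , Nx≡u , N'x≡v , v≻u) ← beaten-somewhere N N' N⋡N'
      let open MeetOfStable N N' ssN ssN'
      top-exists-from a b L (smaller (meet-decreases N N' ssN ssN' x u v Nx≡u N'x≡v v≻u))
        L-stable (L-keeps a b Na≡b N'a≡b)

  top-exists : ∀ a b N → SS N → N a ≡ just b → ¬ ¬ ∃ (IsTop G a b)
  top-exists a b N = top-exists-from a b N (<-wellFounded (totalRank N))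

  same-class : ∀ Y → _∼_ G Y Y
  same-class Y x u v Yx≡u Yx≡v = cong (rankA x) (same-partner Yx≡u Yx≡v)

  -- Every class in C(U(M)) dominates M, through the top matching it dominates.
  InC⇒⪰ : ∀ M Z → SS M → InC G M Z → _⪰_ G Z M
  InC⇒⪰ M Z ssM (_ , _ , a' , b' , Ma'≡b' , N' , (ssN' , _ , N'-top) , Z⪰N') =
    ⪰-trans Z N' M ssN' ssM Z⪰N' (N'-top M ssM Ma'≡b')

  top-InC : ∀ M a b N → M a ≡ just b → IsTop G a b N → InC G M N
  top-InC M a b N Ma≡b top =
    proj₁ top , (a , b , N , top , same-class N) ,
    (a , b , Ma≡b , N , top , λ x u v Nx≡u Nx≡v → ≤-reflexive (same-class N x u v Nx≡u Nx≡v))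

  join-⪰-M : ∀ M X Xs a b → SS M → All (InC G M) (X ∷ Xs) → M a ≡ just b →
    RankAtMost a (rankA a b) (⋁ G X Xs)
  join-⪰-M M X Xs a b ssM (X∈C ∷ Xs∈C) Ma≡b =
    ⋁-bounded a (rankA a b) X Xs (above X∈C) (All.map above Xs∈C)
    where
    above : ∀ {Z} → InC G M Z → RankAtMost a (rankA a b) Z
    above {Z} Z∈C e Za≡e = InC⇒⪰ M Z ssM Z∈C a e b Za≡e Ma≡b

  -- Lower bound: in the join a does no better than in the top matching N of (a,b),
  -- since a listed representative of [N] gives a a partner of rank rankA a b.
  join-⪯-top : ∀ M X Xs a b c N → SS M → RepresentsC G M (X ∷ Xs) → M a ≡ just b →
    IsTop G a b N → ⋁ G X Xs a ≡ just c → rankA a b ≤ rankA a c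
  join-⪯-top M X Xs a b c N ssM (X∈C ∷ Xs∈C , complete , _) Ma≡b top ⋁a≡c =
    conclude _ (All.lookupAny listed (complete N (top-InC M a b N Ma≡b top)))
    where
    Xa : ∃ λ d → X a ≡ just d
    Xa = stays-matched M X ssM (proj₁ X∈C) Ma≡b

    listed : All (λ Z → SS Z × RankAtMost a (rankA a c) Z) (X ∷ Xs)
    listed = All.zip (All.map proj₁ (X∈C ∷ Xs∈C) ,
                      ⋁-bounded⁻¹ a (rankA a c) X Xs (proj₁ Xa) (proj₂ Xa)
                        λ e ⋁a≡e → ≤-reflexive (cong (rankA a) (same-partner ⋁a≡e ⋁a≡c)))

    conclude : ∀ Y → (SS Y × RankAtMost a (rankA a c) Y) × _∼_ G N Y → rankA a b ≤ rankA a c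
    conclude Y ((ssY , Y≤c) , N∼Y) with stays-matched M Y ssM ssY Ma≡b
    ... | e , Ya≡e =
      subst (_≤ rankA a c) (sym (N∼Y a b e (proj₁ (proj₂ top)) Ya≡e)) (Y≤c e Ya≡e)

-- [M] = ⋁ C(U(M)): both bounds hold once a top matching for (a, M a) is given,
-- which exists under ¬¬; the goal is a decidable equation, so ¬¬ can be dropped.

lemma5 : {m n : ℕ} (G : Instance m n) (M : Matching m n) →
    StronglyStable G M →
    (X : Matching m n) (Xs : List (Matching m n)) →
    RepresentsC G M (X ∷ Xs) →
    _∼_ G M (⋁ G X Xs)
lemma5 G M ssM X Xs rep a b c Ma≡b ⋁a≡c =
  decidable-stable (rankA a b ≟ rankA a c) (¬¬-map tight (top-exists G a b M ssM Ma≡b))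
  where
  open Instance G
  tight : ∃ (IsTop G a b) → rankA a b ≡ rankA a c
  tight (N , top) = ≤-antisym
    (join-⪯-top G M X Xs a b c N ssM rep Ma≡b top ⋁a≡c)
    (join-⪰-M G M X Xs a b ssM (proj₁ rep) Ma≡b c ⋁a≡c)
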